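{- Let $A$ be a conflict-free event structure with polarities, and let $\sigma : S \to A$ and $\tau : T \to A^\perp$ be deterministic strategies. Then every finite subset of the pullback $S\circledast T$ of $\sigma$ and $\tau$ is consistent. Consequently, deterministic strategies are stable under composition.
   Context: A strategy is a courteous receptive map of event structures with polarities (courteous: if $s_1<s_2$ with no event strictly in between and ${\it pol}(s_1)=+$ or ${\it pol}(s_2)=-$, then $\sigma s_1<\sigma s_2$ with nothing strictly in between; receptive: negative extensions of the image of a configuration lift uniquely). For $A$ conflict-free (every finite subset consistent, as is the case for games of the form $!A$ built from arenas), a strategy $\sigma:S\to A$ is deterministic iff every finite subset of $S$ is consistent. $S\circledast T=\Pr(\mathcal{C}(S)\times\mathcal{C}(T)\upharpoonright\{(s,t)\mid\sigma s=\tau t\})$, whose configurations correspond to secured bijections $x\cong\sigma x=\tau y\cong y$; composition of strategies is the projection of such a pullback to visible events. -}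

module Defs where

open import Data.List using (List; []; _∷_; map; [_])
open import Data.List.Membership.Propositional using (_∈_; _∉_)
open import Data.List.Relation.Binary.Subset.Propositional using (_⊆_)
open import Data.List.Relation.Unary.All using (All)
open import Data.Product using (Σ; _×_; _,_; proj₁; proj₂)
open import Data.Sum using (_⊎_)
open import Relation.Binary.PropositionalEquality using (_≡_; _≢_)
open import Relation.Binary.Construct.Closure.ReflexiveTransitive using (Star)
open import Relation.Nullary using (¬_)
open import Function.Bundles using (_⇔_)

data Pol : Set where
  ⊕ ⊖ : Pol

dualPol : Pol → Pol
dualPol ⊕ = ⊖
dualPol ⊖ = ⊕

-- Event structures with polarities.
-- Consistency is a predicate on finite subsets, represented as lists
-- (read as sets via propositional membership).

record ESP : Set₁ where
  field
    E             : Set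
    _≤_           : E → E → Set
    ≤-refl        : ∀ {e} → e ≤ e
    ≤-trans       : ∀ {e e′ e″} → e ≤ e′ → e′ ≤ e″ → e ≤ e″
    ≤-antisym     : ∀ {e e′} → e ≤ e′ → e′ ≤ e → e ≡ e′
    finite-causes : ∀ e → Σ (List E) λ l → ∀ e′ → (e′ ≤ e) ⇔ (e′ ∈ l)
    Con           : List E → Set
    Con-sub       : ∀ {X Y} → X ⊆ Y → Con Y → Con X
    Con-sing      : ∀ e → Con [ e ]
    Con-down      : ∀ {X e e′} → Con X → e ∈ X → e′ ≤ e → Con (e′ ∷ X)
    pol           : E → Pol

open ESP public using (E; Con; pol)

module _ (A : ESP) where
  open ESP A using (_≤_)

  _<_ : E A → E A → Set
  e < e′ = e ≤ e′ × e ≢ e′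

  _⋖_ : E A → E A → Set
  e ⋖ e′ = e < e′ × (∀ e″ → ¬ (e < e″ × e″ < e′))

  IsConfig : List (E A) → Set
  IsConfig x = Con A x × (∀ {e e′} → e ∈ x → e′ ≤ e → e′ ∈ x)

  ConflictFree : Set
  ConflictFree = ∀ (X : List (E A)) → Con A X

dual : ESP → ESP
dual A = record
  { E = E A ; _≤_ = ESP._≤_ A ; ≤-refl = ESP.≤-refl A ; ≤-trans = ESP.≤-trans A
  ; ≤-antisym = ESP.≤-antisym A ; finite-causes = ESP.finite-causes A
  ; Con = Con A ; Con-sub = ESP.Con-sub A ; Con-sing = ESP.Con-sing A
  ; Con-down = ESP.Con-down A ; pol = λ e → dualPol (pol A e) }

record IsMap (S A : ESP) (f : E S → E A) : Set where
  field
    config-pres : ∀ x → IsConfig S x → IsConfig A (map f x)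
    loc-inj     : ∀ x → IsConfig S x → ∀ {s s′} → s ∈ x → s′ ∈ x →
                  f s ≡ f s′ → s ≡ s′
    pol-pres    : ∀ s → pol A (f s) ≡ pol S s

record Strategy (S A : ESP) : Set where
  field
    fun        : E S → E A
    isMap      : IsMap S A fun
    courteous  : ∀ s₁ s₂ → _⋖_ S s₁ s₂ → (pol S s₁ ≡ ⊕ ⊎ pol S s₂ ≡ ⊖) →
                 _⋖_ A (fun s₁) (fun s₂)
    receptive  : ∀ x → IsConfig S x → ∀ a → pol A a ≡ ⊖ → a ∉ map fun x →
                 IsConfig A (a ∷ map fun x) →
                 Σ (E S) λ s → (s ∉ x × IsConfig S (s ∷ x) × fun s ≡ a) ×
                   (∀ s′ → s′ ∉ x → IsConfig S (s′ ∷ x) → fun s′ ≡ a → s′ ≡ s)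

-- Determinism, in the form given for conflict-free games A:
-- every finite subset of S is consistent.
Deterministic : ∀ {S A} → Strategy S A → Set
Deterministic {S} σ = ∀ (X : List (E S)) → Con S X

-- The pullback S ⊛ T = Pr(C(S) × C(T) ↾ {(s,t) | σ s = τ t}).
-- Its configurations are the secured bijections; its events are the
-- prime secured bijections [p]_θ; a finite set of events is consistent
-- iff it is bounded by a secured bijection.

module Pullback {A S T : ESP} (σ : Strategy S A) (τ : Strategy T (dual A)) where
  private
    σf = Strategy.fun σ
    τf = Strategy.fun τ

  Pair : Set
  Pair = E S × E T

  Step : List Pair → Pair → Pair → Set
  Step θ p q = p ∈ θ × q ∈ θ ×
               (ESP._≤_ S (proj₁ p) (proj₁ q) ⊎ ESP._≤_ T (proj₂ p) (proj₂ q))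

  _≤[_]_ : Pair → List Pair → Pair → Set
  p ≤[ θ ] q = Star (Step θ) p q

  record SecuredBij (θ : List Pair) : Set where
    field
      matching     : ∀ {p} → p ∈ θ → σf (proj₁ p) ≡ τf (proj₂ p)
      left-config  : IsConfig S (map proj₁ θ)
      right-config : IsConfig T (map proj₂ θ)
      left-inj     : ∀ {p q} → p ∈ θ → q ∈ θ → proj₁ p ≡ proj₁ q → p ≡ q
      right-inj    : ∀ {p q} → p ∈ θ → q ∈ θ → proj₂ p ≡ proj₂ q → p ≡ q
      secured      : ∀ {p q} → p ∈ θ → q ∈ θ → p ≤[ θ ] q → q ≤[ θ ] p → p ≡ q

  record Ev : Set where
    field
      θ     : List Pair
      θ-sec : SecuredBij θ
      top   : Pair
      top∈  : top ∈ θ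

  _∈prime_ : Pair → Ev → Set
  q ∈prime e = q ∈ Ev.θ e × q ≤[ Ev.θ e ] Ev.top e

  ConPb : List Ev → Set
  ConPb X = Σ (List Pair) λ θ′ → SecuredBij θ′ ×
            All (λ e → ∀ q → q ∈prime e → q ∈ θ′) X

-- A finite set of events of S ⊛ T is bounded by the union of the secured
-- bijections defining them.  This union is again a secured bijection: its two
-- projections are consistent because σ and τ are deterministic and down-closed
-- as unions of down-closed sets; it is injective on each side because an
-- equation σ s = σ s′ transfers through the matching to τ t = τ t′, where local
-- injectivity of τ on the (consistent) right projection applies; and each
-- component is down-closed for the causal order of the union, so a cycle of
-- that order through one component stays inside it, where it is trivial.
module Submission where

open import Defs
open import Data.List using (List; []; _∷_; map; _++_)
open import Data.List.Properties using (map-++)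
open import Data.List.Membership.Propositional using (_∈_)
open import Data.List.Membership.Propositional.Properties using (∈-map⁺; ∈-map⁻; ∈-++⁺ˡ; ∈-++⁺ʳ; ∈-++⁻)
open import Data.List.Relation.Unary.All as All using ([]; _∷_)
open import Data.Product using (_×_; _,_; proj₁; proj₂)
open import Data.Product.Properties using (×-≡,≡→≡)
open import Data.Sum using (inj₁; inj₂; [_,_])
open import Relation.Binary.PropositionalEquality using (_≡_; sym; trans; cong; subst)
open import Relation.Binary.Construct.Closure.ReflexiveTransitive using (ε; _◅_)

DownClosed : (X : ESP) → List (E X) → Set
DownClosed X l = ∀ {e e′} → e ∈ l → ESP._≤_ X e′ e → e′ ∈ l

++-downClosed : ∀ (X : ESP) (l₁ l₂ : List (E X)) →
  DownClosed X l₁ → DownClosed X l₂ → DownClosed X (l₁ ++ l₂)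
++-downClosed X l₁ l₂ d₁ d₂ e∈ e′≤e =
  [ (λ e∈₁ → ∈-++⁺ˡ (d₁ e∈₁ e′≤e)) , (λ e∈₂ → ∈-++⁺ʳ l₁ (d₂ e∈₂ e′≤e)) ] (∈-++⁻ l₁ e∈)

map-++-downClosed : ∀ {P : Set} (X : ESP) (f : P → E X) (θ₁ θ₂ : List P) →
  DownClosed X (map f θ₁) → DownClosed X (map f θ₂) → DownClosed X (map f (θ₁ ++ θ₂))
map-++-downClosed X f θ₁ θ₂ d₁ d₂ rewrite map-++ f θ₁ θ₂ =
  ++-downClosed X (map f θ₁) (map f θ₂) d₁ d₂

module DeterministicPullback {A S T : ESP} (σ : Strategy S A) (τ : Strategy T (dual A))
  (σ-det : Deterministic σ) (τ-det : Deterministic τ) where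
  open Pullback σ τ
  open SecuredBij

  private
    σf = Strategy.fun σ
    τf = Strategy.fun τ

  SecuredBij-[] : SecuredBij []
  SecuredBij-[] = record
    { matching     = λ ()
    ; left-config  = σ-det [] , λ ()
    ; right-config = τ-det [] , λ ()
    ; left-inj     = λ ()
    ; right-inj    = λ ()
    ; secured      = λ ()
    }

  module Union {θ₁ θ₂ : List Pair} (sb₁ : SecuredBij θ₁) (sb₂ : SecuredBij θ₂) where
    θ = θ₁ ++ θ₂

    matching-++ : ∀ {p} → p ∈ θ → σf (proj₁ p) ≡ τf (proj₂ p)
    matching-++ p∈ = [ matching sb₁ , matching sb₂ ] (∈-++⁻ θ₁ p∈)

    left-config-++ : IsConfig S (map proj₁ θ)
    left-config-++ = σ-det _ ,
      map-++-downClosed S proj₁ θ₁ θ₂ (proj₂ (left-config sb₁)) (proj₂ (left-config sb₂))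

    right-config-++ : IsConfig T (map proj₂ θ)
    right-config-++ = τ-det _ ,
      map-++-downClosed T proj₂ θ₁ θ₂ (proj₂ (right-config sb₁)) (proj₂ (right-config sb₂))

    left-inj-++ : ∀ {p q} → p ∈ θ → q ∈ θ → proj₁ p ≡ proj₁ q → p ≡ q
    left-inj-++ {p} {q} p∈ q∈ s≡s′ = ×-≡,≡→≡ (s≡s′ , t≡t′)
      where
      τt≡τt′ : τf (proj₂ p) ≡ τf (proj₂ q)
      τt≡τt′ = trans (sym (matching-++ p∈)) (trans (cong σf s≡s′) (matching-++ q∈))
      t≡t′ : proj₂ p ≡ proj₂ q
      t≡t′ = IsMap.loc-inj (Strategy.isMap τ) _ right-config-++
               (∈-map⁺ proj₂ p∈) (∈-map⁺ proj₂ q∈) τt≡τt′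

    right-inj-++ : ∀ {p q} → p ∈ θ → q ∈ θ → proj₂ p ≡ proj₂ q → p ≡ q
    right-inj-++ {p} {q} p∈ q∈ t≡t′ = ×-≡,≡→≡ (s≡s′ , t≡t′)
      where
      σs≡σs′ : σf (proj₁ p) ≡ σf (proj₁ q)
      σs≡σs′ = trans (matching-++ p∈) (trans (cong τf t≡t′) (sym (matching-++ q∈)))
      s≡s′ : proj₁ p ≡ proj₁ q
      s≡s′ = IsMap.loc-inj (Strategy.isMap σ) _ left-config-++
               (∈-map⁺ proj₁ p∈) (∈-map⁺ proj₁ q∈) σs≡σs′

    module Component {θᵢ : List Pair} (sbᵢ : SecuredBij θᵢ) (θᵢ⊆θ : ∀ {p} → p ∈ θᵢ → p ∈ θ) where

      Step-downClosed : ∀ {p q} → q ∈ θᵢ → Step θ p q → p ∈ θᵢ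
      Step-downClosed q∈ (p∈ , _ , inj₁ s≤s′)
        with r , r∈ , s≡ ← ∈-map⁻ proj₁ (proj₂ (left-config sbᵢ) (∈-map⁺ proj₁ q∈) s≤s′)
        = subst (_∈ θᵢ) (left-inj-++ (θᵢ⊆θ r∈) p∈ (sym s≡)) r∈
      Step-downClosed q∈ (p∈ , _ , inj₂ t≤t′)
        with r , r∈ , t≡ ← ∈-map⁻ proj₂ (proj₂ (right-config sbᵢ) (∈-map⁺ proj₂ q∈) t≤t′)
        = subst (_∈ θᵢ) (right-inj-++ (θᵢ⊆θ r∈) p∈ (sym t≡)) r∈

      ≤-restrict : ∀ {p q} → q ∈ θᵢ → p ≤[ θ ] q → p ∈ θᵢ × p ≤[ θᵢ ] q
      ≤-restrict q∈ ε = q∈ , ε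
      ≤-restrict {p} q∈ (step ◅ path) with r∈ , path′ ← ≤-restrict q∈ path =
        p∈ , ((p∈ , r∈ , proj₂ (proj₂ step)) ◅ path′)
        where
        p∈ : p ∈ θᵢ
        p∈ = Step-downClosed r∈ step

      secured-below : ∀ {p q} → q ∈ θᵢ → p ≤[ θ ] q → q ≤[ θ ] p → p ≡ q
      secured-below q∈ p≤q q≤p with p∈ , p≤ᵢq ← ≤-restrict q∈ p≤q =
        secured sbᵢ p∈ q∈ p≤ᵢq (proj₂ (≤-restrict p∈ q≤p))

    secured-++ : ∀ {p q} → p ∈ θ → q ∈ θ → p ≤[ θ ] q → q ≤[ θ ] p → p ≡ q
    secured-++ _ q∈ =
      [ Component.secured-below sb₁ ∈-++⁺ˡ , Component.secured-below sb₂ (∈-++⁺ʳ θ₁) ] (∈-++⁻ θ₁ q∈)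

    SecuredBij-++ : SecuredBij θ
    SecuredBij-++ = record
      { matching     = matching-++
      ; left-config  = left-config-++
      ; right-config = right-config-++
      ; left-inj     = left-inj-++
      ; right-inj    = right-inj-++
      ; secured      = secured-++
      }

  open Union using (SecuredBij-++)

  ConPb-all : ∀ (X : List Ev) → ConPb X
  ConPb-all [] = [] , SecuredBij-[] , []
  ConPb-all (e ∷ X) with θ′ , sb′ , bounded ← ConPb-all X =
    Ev.θ e ++ θ′ ,
    SecuredBij-++ (Ev.θ-sec e) sb′ ,
    (λ q q∈ → ∈-++⁺ˡ (proj₁ q∈)) ∷ All.map (λ h q q∈ → ∈-++⁺ʳ (Ev.θ e) (h q q∈)) bounded

lemma28 : ∀ {A S T : ESP} (σ : Strategy S A) (τ : Strategy T (dual A)) →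
    ConflictFree A → Deterministic σ → Deterministic τ →
    ∀ (X : List (Pullback.Ev σ τ)) → Pullback.ConPb σ τ X
lemma28 σ τ _ σ-det τ-det = DeterministicPullback.ConPb-all σ τ σ-det τ-det
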